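{- Let $\mathbb{C}$ be a small coconfluent category, $P$ an atomic sheaf on $\mathbb{C}$ and $Q\subseteq P$ a subsheaf. If $x,x'\in P(X)$ satisfy $(x,x')\in\sim_P(X)$ and $x\in Q(X)$, then $x'\in Q(X)$.
   Context: Presheaf notation $x\cdot f := P(f)(x)$. Coconfluent: every cospan $X\to Z\leftarrow Y$ has a span $X\xleftarrow{u}W\xrightarrow{v}Y$ making the square commute. Atomic sheaf: for every $c\colon Y\to X$, every $y\in P(Y)$ with $y\cdot d=y\cdot e$ whenever $c\circ d=c\circ e$ equals $x\cdot c$ for a unique $x\in P(X)$. A subsheaf $Q\subseteq P$ is a family $Q(X)\subseteq P(X)$ such that for all $f\colon Y\to X$ and $x\in P(X)$: $x\in Q(X)$ implies $x\cdot f\in Q(Y)$, and $x\cdot f\in Q(Y)$ implies $x\in Q(X)$. Atomic equivalence: $\sim_P(X) = \{(x,x')\in P(X)^2\mid \exists Z\,\exists u,u'\colon Z\to X.\ x\cdot u = x'\cdot u'\}$. -}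

module Defs where

open import Level using (Level; _⊔_; suc)
open import Data.Product using (Σ; ∃; ∃-syntax; _×_; _,_)
open import Relation.Binary.PropositionalEquality using (_≡_)

record Category (o h : Level) : Set (suc (o ⊔ h)) where
  infixr 9 _∘_
  field
    Obj  : Set o
    Hom  : Obj → Obj → Set h
    id   : ∀ {X} → Hom X X
    _∘_  : ∀ {X Y Z} → Hom Y Z → Hom X Y → Hom X Z
    identityˡ : ∀ {X Y} (f : Hom X Y) → id ∘ f ≡ f
    identityʳ : ∀ {X Y} (f : Hom X Y) → f ∘ id ≡ f
    assoc     : ∀ {W X Y Z} (h : Hom Y Z) (g : Hom X Y) (f : Hom W X) →
                (h ∘ g) ∘ f ≡ h ∘ (g ∘ f)

module _ {o h : Level} (𝒞 : Category o h) where
  open Category 𝒞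

  Coconfluent : Set (o ⊔ h)
  Coconfluent = ∀ {X Y Z} (f : Hom X Z) (g : Hom Y Z) →
    ∃[ W ] Σ (Hom W X) λ u → Σ (Hom W Y) λ v → f ∘ u ≡ g ∘ v

  -- A (Set-valued) presheaf on 𝒞, with right action x · f := P(f)(x).
  record Presheaf (p : Level) : Set (o ⊔ h ⊔ suc p) where
    infixl 8 _·_
    field
      F    : Obj → Set p
      _·_  : ∀ {X Y} → F X → Hom Y X → F Y
      ·-id : ∀ {X} (x : F X) → x · id ≡ x
      ·-∘  : ∀ {X Y Z} (x : F X) (f : Hom Y X) (g : Hom Z Y) →
             x · (f ∘ g) ≡ (x · f) · g

  module _ {p : Level} (P : Presheaf p) where
    open Presheaf P

    IsAtomicSheaf : Set (o ⊔ h ⊔ p)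
    IsAtomicSheaf =
      ∀ {X Y} (c : Hom Y X) (y : F Y) →
      (∀ {V} (d e : Hom V Y) → c ∘ d ≡ c ∘ e → y · d ≡ y · e) →
      Σ (F X) λ x → (x · c ≡ y) × (∀ (x' : F X) → x' · c ≡ y → x' ≡ x)

    record Subsheaf (q : Level) : Set (o ⊔ h ⊔ p ⊔ suc q) where
      field
        Q        : ∀ X → F X → Set q
        restrict : ∀ {X Y} (f : Hom Y X) (x : F X) → Q X x → Q Y (x · f)
        reflect  : ∀ {X Y} (f : Hom Y X) (x : F X) → Q Y (x · f) → Q X x

    AtomicEquiv : ∀ X → F X → F X → Set (o ⊔ h ⊔ p)
    AtomicEquiv X x x' =
      ∃[ Z ] Σ (Hom Z X) λ u → Σ (Hom Z X) λ u' → x · u ≡ x' · u'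

module Submission where

open import Level using (Level)
open import Defs
open import Data.Product using (_,_)
open import Relation.Binary.PropositionalEquality using (_≡_; subst)

module _ {o h p q : Level} {𝒞 : Category o h} {P : Presheaf 𝒞 p}
         (S : Subsheaf 𝒞 P q) where
  open Category 𝒞
  open Presheaf P
  open Subsheaf S

  Q-transport : ∀ {X Y Z} (u : Hom Z X) (u' : Hom Z Y) {x : F X} {y : F Y} →
                x · u ≡ y · u' → Q X x → Q Y y
  Q-transport u u' {x} {y} eq qx = reflect u' y (subst (Q _) eq (restrict u x qx))

  Q-respects-AtomicEquiv : ∀ X {x x'} → AtomicEquiv 𝒞 P X x x' → Q X x → Q X x'
  Q-respects-AtomicEquiv X (Z , u , u' , eq) = Q-transport u u' eq

lemma5p3 : {o h p q : Level} (𝒞 : Category o h) → Coconfluent 𝒞 →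
    (P : Presheaf 𝒞 p) → IsAtomicSheaf 𝒞 P →
    (S : Subsheaf 𝒞 P q) →
    ∀ X (x x' : Presheaf.F P X) →
    AtomicEquiv 𝒞 P X x x' → Subsheaf.Q S X x → Subsheaf.Q S X x'
lemma5p3 𝒞 _ P _ S X x x' = Q-respects-AtomicEquiv S X
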